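{- Let $G$ be an equitably 3-colorable graph on $n\ge 2$ vertices and let $l\ge 1$. If $m\in\{2,3,5\}$, then $\chi_{=}(G\circ^l P_m)=3$.
   Context: All graphs are finite, simple and connected. $P_m$ denotes the path on $m$ vertices. A graph is equitably $k$-colorable if its vertex set can be partitioned into $k$ (possibly empty) independent sets $V_1,\dots,V_k$ with $||V_i|-|V_j||\le 1$ for all $i,j$; $\chi_{=}(G)$ is the least $k$ for which $G$ is equitably $k$-colorable. The corona $G\circ H$ is formed from one copy of $G$ and $|V(G)|$ copies of $H$, the $i$-th vertex of $G$ being joined to every vertex of the $i$-th copy of $H$; $G\circ^1 H=G\circ H$ and $G\circ^l H=(G\circ^{l-1}H)\circ H$ for $l\ge 2$. -}

module Defs where

open import Data.Nat using (ℕ; zero; suc; _+_; _*_; _≤_)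
open import Data.Bool using (Bool; true; false; _∧_)
open import Data.Fin using (Fin; toℕ; splitAt; quotRem; _≟_)
open import Data.Sum using (_⊎_; inj₁; inj₂)
open import Data.Product using (_×_; _,_; Σ; ∃)
open import Data.List using (List; length; filter)
open import Data.List using (allFin) public
open import Relation.Nullary using (¬_)
open import Relation.Nullary.Decidable using (⌊_⌋)
open import Relation.Binary.PropositionalEquality using (_≡_; _≢_)
import Data.Nat as ℕ

record Graph : Set where
  constructor mkGraph
  field
    size : ℕ
    adj  : Fin size → Fin size → Bool
open Graph public

IsSimple : Graph → Set
IsSimple G = (∀ u → adj G u u ≡ false) × (∀ u v → adj G u v ≡ adj G v u)

data Reach (G : Graph) : Fin (size G) → Fin (size G) → Set where
  here  : ∀ {u} → Reach G u u
  step  : ∀ {u v w} → adj G u v ≡ true → Reach G v w → Reach G u w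

Connected : Graph → Set
Connected G = ∀ u v → Reach G u v

P : ℕ → Graph
P m = mkGraph m (λ i j → ⌊ toℕ i ℕ.≟ suc (toℕ j) ⌋ Data.Bool.∨ ⌊ toℕ j ℕ.≟ suc (toℕ i) ⌋)

-- Corona G ∘ H. Vertices: Fin (|G| + |G|·|H|); the first |G| are the copy
-- of G, and vertex (j , c) of the second block (via quotRem) is vertex j of
-- the c-th copy of H.
corona : Graph → Graph → Graph
corona G H = mkGraph (size G + size G * size H) A
  where
  n = size G
  m = size H
  A : Fin (n + n * m) → Fin (n + n * m) → Bool
  A x y with splitAt n x | splitAt n y
  ... | inj₁ a | inj₁ b = adj G a b
  ... | inj₁ a | inj₂ q with quotRem {n} m q
  ...   | (j , c) = ⌊ a ≟ c ⌋
  A x y | inj₂ p | inj₁ b with quotRem {n} m p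
  ...   | (j , c) = ⌊ b ≟ c ⌋
  A x y | inj₂ p | inj₂ q with quotRem {n} m p | quotRem {n} m q
  ...   | (j , c) | (j' , c') = ⌊ c ≟ c' ⌋ ∧ adj H j j'

coronaIter : Graph → Graph → ℕ → Graph
coronaIter G H zero    = G
coronaIter G H (suc l) = corona (coronaIter G H l) H

Proper : (G : Graph) (k : ℕ) → (Fin (size G) → Fin k) → Set
Proper G k c = ∀ u v → adj G u v ≡ true → c u ≢ c v

classSize : (G : Graph) (k : ℕ) → (Fin (size G) → Fin k) → Fin k → ℕ
classSize G k c i = length (filter (λ v → c v ≟ i) (allFin (size G)))

Equitable : (G : Graph) (k : ℕ) → (Fin (size G) → Fin k) → Set
Equitable G k c = ∀ i j → classSize G k c i ≤ suc (classSize G k c j)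

EquitablyColorable : Graph → ℕ → Set
EquitablyColorable G k = Σ (Fin (size G) → Fin k) λ c → Proper G k c × Equitable G k c

EqChromaticIs : Graph → ℕ → Set
EqChromaticIs G k = EquitablyColorable G k × (∀ k' → EquitablyColorable G k' → k ≤ k')

-- A lower bound of 3 comes from a triangle: a vertex of G ∘^(l-1) P_m together with two consecutive
-- vertices of its pendant copy of P_m. For the upper bound, extend an equitable 3-colouring c of H
-- (n ≥ 2 vertices, class sizes A) to H ∘ P_m by colouring the path at v alternately x v, y v, where
-- {c v, x v, y v} = {0, 1, 2}. The path adds ⌈m/2⌉ to the class of x v and ⌊m/2⌋ to that of y v.
-- If x has the same class sizes as c, class i of H ∘ P_m has A i + ⌈m/2⌉ A i + ⌊m/2⌋ (n − 2 A i)
-- vertices, i.e. n, n + A i and 2n for m = 2, 3 and 5, which is balanced in each case.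

module Submission where

open import Defs
open import Data.Bool using (Bool; true; false; not; if_then_else_)
open import Data.Fin
  using (Fin; zero; suc; toℕ; fromℕ<; splitAt; quotRem; combine; _↑ˡ_; _↑ʳ_; _≟_)
open import Data.Fin.Patterns using (0F; 1F; 2F)
open import Data.Fin.Properties using (splitAt-↑ˡ; splitAt-↑ʳ; remQuot-combine)
open import Data.List using (length; filter; tabulate)
open import Data.Nat using (ℕ; zero; suc; _+_; _*_; _∸_; _⊔_; _≤_; z≤n; s≤s; ⌊_/2⌋; ⌈_/2⌉)
import Data.Nat as ℕ
open import Data.Nat.Properties hiding (_≟_)
open import Data.Nat.Tactic.RingSolver using (solve-∀)
open import Data.Product using (Σ; _×_; _,_; proj₁; proj₂; swap; uncurry)
open import Data.Sum using (_⊎_; inj₁; inj₂)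
open import Data.Vec.Functional using (_++_; concat; _∷_)
open import Data.Vec.Functional.Properties using (lookup-++ˡ; lookup-++ʳ)
open import Function using (_∘_; flip)
open import Relation.Nullary using (yes; no; does; contradiction)
open import Relation.Unary using (Pred; Decidable)
open import Relation.Binary.PropositionalEquality
open import Algebra.Properties.CommutativeSemigroup +-commutativeSemigroup using (xy∙z≈xz∙y)
open import Algebra.Properties.Semiring.Sum +-*-semiring
  using (sum; sum-syntax; sum-cong-≗; ∑-distrib-+; *-distribˡ-sum)

∑-↑ : ∀ m {n} (g : Fin (m + n) → ℕ) →
      sum g ≡ ∑[ i < m ] g (i ↑ˡ n) + ∑[ j < n ] g (m ↑ʳ j)
∑-↑ zero    g = refl
∑-↑ (suc m) g = trans (cong (g zero +_) (∑-↑ m (g ∘ suc))) (sym (+-assoc (g zero) _ _))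

∑-combine : ∀ m {n} (g : Fin (m * n) → ℕ) →
            sum g ≡ ∑[ i < m ] ∑[ j < n ] g (combine i j)
∑-combine zero    g = refl
∑-combine (suc m) {n} g =
  trans (∑-↑ n g) (cong (∑[ j < n ] g (j ↑ˡ (m * n)) +_) (∑-combine m (g ∘ (n ↑ʳ_))))

∑-one : ∀ n → ∑[ v < n ] 1 ≡ n
∑-one zero    = refl
∑-one (suc n) = cong suc (∑-one n)

∑-partition : ∀ {n} (f g h : Fin n → ℕ) → (∀ v → f v + g v + h v ≡ 1) →
              sum f + sum g + sum h ≡ n
∑-partition {n} f g h f+g+h≡1 = begin
  sum f + sum g + sum h               ≡⟨ cong (_+ sum h) (∑-distrib-+ f g) ⟨
  sum (λ v → f v + g v) + sum h       ≡⟨ ∑-distrib-+ (λ v → f v + g v) h ⟨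
  sum (λ v → f v + g v + h v)         ≡⟨ sum-cong-≗ f+g+h≡1 ⟩
  ∑[ v < n ] 1                        ≡⟨ ∑-one n ⟩
  n                                   ∎
  where open ≡-Reasoning

δ : ∀ {k} → Fin k → Fin k → ℕ
δ a b = if does (a ≟ b) then 1 else 0

count : ∀ {n k} → (Fin n → Fin k) → Fin k → ℕ
count {n} c i = ∑[ v < n ] δ (c v) i

Balanced : ∀ {k} → (Fin k → ℕ) → Set
Balanced A = ∀ i j → A i ≤ suc (A j)

length-filter-tabulate : ∀ {a p} {A : Set a} {P : Pred A p} (P? : Decidable P) {n} (f : Fin n → A) →
  length (filter P? (tabulate f)) ≡ ∑[ v < n ] (if does (P? (f v)) then 1 else 0)
length-filter-tabulate P? {zero}  f = refl
length-filter-tabulate P? {suc n} f with does (P? (f zero))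
... | true  = cong suc (length-filter-tabulate P? (f ∘ suc))
... | false = length-filter-tabulate P? (f ∘ suc)

classSize≡count : ∀ G k (c : Fin (size G) → Fin k) i → classSize G k c i ≡ count c i
classSize≡count G k c i = length-filter-tabulate (λ v → c v ≟ i) (λ v → v)

equitable⇒balanced : ∀ G k (c : Fin (size G) → Fin k) → Equitable G k c → Balanced (count c)
equitable⇒balanced G k c eq i j =
  subst₂ (λ a b → a ≤ suc b) (classSize≡count G k c i) (classSize≡count G k c j) (eq i j)

balanced⇒equitable : ∀ G k (c : Fin (size G) → Fin k) → Balanced (count c) → Equitable G k c
balanced⇒equitable G k c bal i j =
  subst₂ (λ a b → a ≤ suc b) (sym (classSize≡count G k c i)) (sym (classSize≡count G k c j)) (bal i j)

count-++ : ∀ {m n k} (xs : Fin m → Fin k) (ys : Fin n → Fin k) i →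
           count (xs ++ ys) i ≡ count xs i + count ys i
count-++ {m} xs ys i = trans (∑-↑ m _) (cong₂ _+_
  (sum-cong-≗ (λ v → cong (λ a → δ a i) (lookup-++ˡ xs ys v)))
  (sum-cong-≗ (λ v → cong (λ a → δ a i) (lookup-++ʳ xs ys v))))

quotRem-combine : ∀ {n m} (v : Fin n) (j : Fin m) → quotRem {n} m (combine v j) ≡ (j , v)
quotRem-combine v j = cong swap (remQuot-combine v j)

concat-combine : ∀ {n m} {A : Set} (xss : Fin n → Fin m → A) v j → concat xss (combine v j) ≡ xss v j
concat-combine xss v j = cong (uncurry (flip xss)) (quotRem-combine v j)

count-concat : ∀ {n m k} (xss : Fin n → Fin m → Fin k) i →
               count (concat xss) i ≡ ∑[ v < n ] count (xss v) i
count-concat {n} xss i = trans (∑-combine n _)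
  (sum-cong-≗ (λ v → sum-cong-≗ (λ j → cong (λ a → δ a i) (concat-combine xss v j))))

-- c ++ concat p colours the copy of H by c and vertex j of the v-th copy of F by p v j, matching
-- the splitAt/quotRem layout of corona.
corona-proper : ∀ H F {k} (c : Fin (size H) → Fin k) (p : Fin (size H) → Fin (size F) → Fin k) →
  Proper H k c → (∀ v → Proper F k (p v)) → (∀ v j → p v j ≢ c v) →
  Proper (corona H F) k (c ++ concat p)
corona-proper H F c p c-proper p-proper p≢c x y e with splitAt (size H) x | splitAt (size H) y
... | inj₁ a | inj₁ b = c-proper a b e
... | inj₁ a | inj₂ q with quotRem {size H} (size F) q
...   | j , v with a ≟ v
...     | yes refl = p≢c a j ∘ sym
corona-proper H F c p c-proper p-proper p≢c x y e | inj₂ q | inj₁ b with quotRem {size H} (size F) q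
...   | j , v with b ≟ v
...     | yes refl = p≢c b j
corona-proper H F c p c-proper p-proper p≢c x y e | inj₂ q | inj₂ q′
  with quotRem {size H} (size F) q | quotRem {size H} (size F) q′
...   | j , v | j′ , v′ with v ≟ v′
...     | yes refl = p-proper v j j′ e

corona-adj-hub-copy : ∀ H F (v : Fin (size H)) (j : Fin (size F)) →
  adj (corona H F) (v ↑ˡ (size H * size F)) (size H ↑ʳ combine v j) ≡ true
corona-adj-hub-copy H F v j
  rewrite splitAt-↑ˡ (size H) v (size H * size F)
        | splitAt-↑ʳ (size H) (size H * size F) (combine v j)
        | quotRem-combine v j | ≡-≟-identity _≟_ {v} refl = refl

corona-adj-copy : ∀ H F (v : Fin (size H)) (j j′ : Fin (size F)) →
  adj (corona H F) (size H ↑ʳ combine v j) (size H ↑ʳ combine v j′) ≡ adj F j j′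
corona-adj-copy H F v j j′
  rewrite splitAt-↑ʳ (size H) (size H * size F) (combine v j)
        | splitAt-↑ʳ (size H) (size H * size F) (combine v j′)
        | quotRem-combine v j | quotRem-combine v j′ | ≡-≟-identity _≟_ {v} refl = refl

alternate : ∀ {A : Set} → A → A → ℕ → A
alternate x y zero    = x
alternate x y (suc j) = alternate y x j

alternate-≢ : ∀ {A : Set} {x y a : A} → x ≢ a → y ≢ a → ∀ j → alternate x y j ≢ a
alternate-≢ x≢a y≢a zero    = x≢a
alternate-≢ x≢a y≢a (suc j) = alternate-≢ y≢a x≢a j

alternate-suc-≢ : ∀ {A : Set} {x y : A} → x ≢ y → ∀ j → alternate x y (suc j) ≢ alternate x y j
alternate-suc-≢ x≢y zero    = x≢y ∘ sym
alternate-suc-≢ x≢y (suc j) = alternate-suc-≢ (x≢y ∘ sym) j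

alternate-proper : ∀ {m k} {x y : Fin k} → x ≢ y → Proper (P m) k (alternate x y ∘ toℕ)
alternate-proper x≢y i j e with toℕ i ℕ.≟ suc (toℕ j) | toℕ j ℕ.≟ suc (toℕ i)
... | yes i≡1+j | _         rewrite i≡1+j = alternate-suc-≢ x≢y (toℕ j)
... | no _      | yes j≡1+i rewrite j≡1+i = alternate-suc-≢ x≢y (toℕ i) ∘ sym

count-alternate : ∀ m {k} (x y : Fin k) i →
  count (alternate x y ∘ toℕ {m}) i ≡ ⌈ m /2⌉ * δ x i + ⌊ m /2⌋ * δ y i
count-alternate zero    x y i = refl
count-alternate (suc m) x y i = begin
  δ x i + count (alternate y x ∘ toℕ {m}) i    ≡⟨ cong (δ x i +_) (count-alternate m y x i) ⟩
  δ x i + (⌈ m /2⌉ * δ y i + ⌊ m /2⌋ * δ x i)  ≡⟨ regroup (δ x i) (δ y i) ⌈ m /2⌉ ⌊ m /2⌋ ⟩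
  suc ⌊ m /2⌋ * δ x i + ⌈ m /2⌉ * δ y i        ∎
  where
  open ≡-Reasoning
  regroup : ∀ a b p q → a + (p * b + q * a) ≡ suc q * a + p * b
  regroup = solve-∀

count-corona-alternate : ∀ {n} m {k} (c x y : Fin n → Fin k) i →
  count (c ++ concat (λ v → alternate (x v) (y v) ∘ toℕ {m})) i ≡
  count c i + (⌈ m /2⌉ * count x i + ⌊ m /2⌋ * count y i)
count-corona-alternate {n} m c x y i = begin
  count (c ++ concat (λ v → alternate (x v) (y v) ∘ toℕ)) i
    ≡⟨ count-++ c _ i ⟩
  count c i + count (concat (λ v → alternate (x v) (y v) ∘ toℕ)) i
    ≡⟨ cong (count c i +_) (count-concat (λ v → alternate (x v) (y v) ∘ toℕ {m}) i) ⟩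
  count c i + ∑[ v < n ] count (alternate (x v) (y v) ∘ toℕ {m}) i
    ≡⟨ cong (count c i +_) (sum-cong-≗ (λ v → count-alternate m (x v) (y v) i)) ⟩
  count c i + ∑[ v < n ] (⌈ m /2⌉ * δ (x v) i + ⌊ m /2⌋ * δ (y v) i)
    ≡⟨ cong (count c i +_) (∑-distrib-+ (λ v → ⌈ m /2⌉ * δ (x v) i) (λ v → ⌊ m /2⌋ * δ (y v) i)) ⟩
  count c i + (∑[ v < n ] (⌈ m /2⌉ * δ (x v) i) + ∑[ v < n ] (⌊ m /2⌋ * δ (y v) i))
    ≡⟨ cong (count c i +_) (cong₂ _+_ (*-distribˡ-sum ⌈ m /2⌉ (λ v → δ (x v) i))
                                      (*-distribˡ-sum ⌊ m /2⌋ (λ v → δ (y v) i))) ⟨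
  count c i + (⌈ m /2⌉ * count x i + ⌊ m /2⌋ * count y i) ∎
  where open ≡-Reasoning

next : Fin 3 → Fin 3
next 0F = 1F
next 1F = 2F
next 2F = 0F

prev : Fin 3 → Fin 3
prev a = next (next a)

next³ : ∀ a → next (next (next a)) ≡ a
next³ 0F = refl
next³ 1F = refl
next³ 2F = refl

next-≢ : ∀ a → next a ≢ a
next-≢ 0F ()
next-≢ 1F ()
next-≢ 2F ()

prev-≢ : ∀ a → prev a ≢ a
prev-≢ a pa≡a = next-≢ a (trans (sym (cong next pa≡a)) (next³ a))

next≢prev : ∀ a → next a ≢ prev a
next≢prev a = next-≢ (next a) ∘ sym

δ-inverse : ∀ {k} {f g : Fin k → Fin k} → (∀ a → g (f a) ≡ a) → (∀ i → f (g i) ≡ i) →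
            ∀ a i → δ (f a) i ≡ δ a (g i)
δ-inverse {f = f} {g} gf fg a i with f a ≟ i | a ≟ g i
... | yes _    | yes _   = refl
... | no _     | no _    = refl
... | yes refl | no a≢   = contradiction (sym (gf a)) a≢
... | no fa≢   | yes refl = contradiction (fg i) fa≢

δ-next : ∀ a i → δ (next a) i ≡ δ a (prev i)
δ-next = δ-inverse next³ next³

δ-prev : ∀ a i → δ (prev a) i ≡ δ a (next i)
δ-prev = δ-inverse next³ next³

δ-rotations : ∀ a i → δ a i + δ a (next i) + δ a (prev i) ≡ 1
δ-rotations 0F 0F = refl
δ-rotations 0F 1F = refl
δ-rotations 0F 2F = refl
δ-rotations 1F 0F = refl
δ-rotations 1F 1F = refl
δ-rotations 1F 2F = refl
δ-rotations 2F 0F = refl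
δ-rotations 2F 1F = refl
δ-rotations 2F 2F = refl

count-rotations : ∀ {n} (c : Fin n → Fin 3) i → count c i + count c (next i) + count c (prev i) ≡ n
count-rotations c i = ∑-partition _ _ _ (λ v → δ-rotations (c v) i)

turn : Bool → Fin 3 → Fin 3
turn false = next
turn true  = prev

turn-≢ : ∀ b a → turn b a ≢ a
turn-≢ false = next-≢
turn-≢ true  = prev-≢

turn-≢-turn-not : ∀ b a → turn b a ≢ turn (not b) a
turn-≢-turn-not false a = next≢prev a
turn-≢-turn-not true  a = next≢prev a ∘ sym

δ-turns : ∀ b a i → δ a i + δ (turn b a) i + δ (turn (not b) a) i ≡ 1
δ-turns true a i rewrite δ-prev a i | δ-next a i = δ-rotations a i
δ-turns false a i = trans (xy∙z≈xz∙y (δ a i) _ _) (δ-turns true a i)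

countIf : ∀ {n k} → (Fin n → Bool) → (Fin n → Fin k) → Fin k → ℕ
countIf {n} d c i = ∑[ v < n ] (if d v then δ (c v) i else 0)

select : ∀ {n k} (c : Fin n → Fin k) (B : Fin k → ℕ) → (∀ i → B i ≤ count c i) →
         Σ (Fin n → Bool) λ d → ∀ i → countIf d c i ≡ B i
select {zero}  c B B≤count = (λ ()) , λ i → sym (n≤0⇒n≡0 (B≤count i))
select {suc n} c B B≤count
  with select (c ∘ suc) (λ i → B i ∸ δ (c zero) i)
              (λ i → m≤n+o⇒m∸n≤o (B i) (δ (c zero) i) (B≤count i))
... | d , d-counts with B (c zero) in Ba
...   | zero  = false ∷ d , λ i → trans (d-counts i) (B∸δ≡B Ba i)
  where
  B∸δ≡B : B (c zero) ≡ 0 → ∀ i → B i ∸ δ (c zero) i ≡ B i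
  B∸δ≡B Ba≡0 i with c zero ≟ i
  ... | yes refl rewrite Ba≡0 = refl
  ... | no _     = refl
...   | suc _ = true ∷ d , λ i → trans (cong (δ (c zero) i +_) (d-counts i)) (m+[n∸m]≡n (δ≤B Ba i))
  where
  δ≤B : ∀ {b} → B (c zero) ≡ suc b → ∀ i → δ (c zero) i ≤ B i
  δ≤B Ba≡1+b i with c zero ≟ i
  ... | yes refl rewrite Ba≡1+b = s≤s z≤n
  ... | no _     = z≤n

max₃ : (Fin 3 → ℕ) → ℕ
max₃ A = A 0F ⊔ A 1F ⊔ A 2F

≤-max₃ : ∀ A i → A i ≤ max₃ A
≤-max₃ A 0F = ≤-trans (m≤m⊔n (A 0F) (A 1F)) (m≤m⊔n _ (A 2F))
≤-max₃ A 1F = ≤-trans (m≤n⊔m (A 0F) (A 1F)) (m≤m⊔n _ (A 2F))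
≤-max₃ A 2F = m≤n⊔m _ (A 2F)

max₃-≤ : ∀ A {b} → (∀ i → A i ≤ b) → max₃ A ≤ b
max₃-≤ A A≤b = ⊔-lub (⊔-lub (A≤b 0F) (A≤b 1F)) (A≤b 2F)

rotation-cases : ∀ j i → i ≡ j ⊎ i ≡ next j ⊎ i ≡ prev j
rotation-cases 0F 0F = inj₁ refl
rotation-cases 0F 1F = inj₂ (inj₁ refl)
rotation-cases 0F 2F = inj₂ (inj₂ refl)
rotation-cases 1F 0F = inj₂ (inj₂ refl)
rotation-cases 1F 1F = inj₁ refl
rotation-cases 1F 2F = inj₂ (inj₁ refl)
rotation-cases 2F 0F = inj₂ (inj₁ refl)
rotation-cases 2F 1F = inj₂ (inj₂ refl)
rotation-cases 2F 2F = inj₁ refl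

≤-sum-of-others : ∀ {a} b c → a ≤ suc b → a ≤ suc c → 2 ≤ c + b + a → a ≤ b + c
≤-sum-of-others b (suc c) a≤1+b _ _ =
  ≤-trans a≤1+b (subst (suc b ≤_) (sym (+-suc b c)) (s≤s (m≤m+n b c)))
≤-sum-of-others (suc b) zero _ a≤1 _   = ≤-trans a≤1 (s≤s z≤n)
≤-sum-of-others zero    zero _ a≤1 2≤a = contradiction (≤-trans 2≤a a≤1) λ { (s≤s ()) }

count≤count-next+count : ∀ {n} (c : Fin n → Fin 3) → 2 ≤ n → Balanced (count c) →
  ∀ j i → count c i ≤ count c (next j) + count c j
count≤count-next+count c 2≤n bal j i with rotation-cases j i
... | inj₁ refl        = m≤n+m _ _
... | inj₂ (inj₁ refl) = m≤m+n _ _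
... | inj₂ (inj₂ refl) = ≤-sum-of-others _ _ (bal (prev j) (next j)) (bal (prev j) j)
                           (subst (2 ≤_) (sym (count-rotations c j)) 2≤n)

δ-turn : ∀ b a i → δ (turn b a) i + (if b then δ a (prev i) else 0)
                 ≡ δ a (prev i) + (if b then δ a (next i) else 0)
δ-turn false a i = cong (_+ 0) (δ-next a i)
δ-turn true  a i = trans (+-comm (δ (prev a) i) _) (cong (δ a (prev i) +_) (δ-prev a i))

count-turn : ∀ {n} (d : Fin n → Bool) (c : Fin n → Fin 3) i →
  count (λ v → turn (d v) (c v)) i + countIf d c (prev i) ≡ count c (prev i) + countIf d c (next i)
count-turn d c i = begin
  count (λ v → turn (d v) (c v)) i + countIf d c (prev i)
    ≡⟨ ∑-distrib-+ (λ v → δ (turn (d v) (c v)) i) (λ v → if d v then δ (c v) (prev i) else 0) ⟨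
  sum (λ v → δ (turn (d v) (c v)) i + (if d v then δ (c v) (prev i) else 0))
    ≡⟨ sum-cong-≗ (λ v → δ-turn (d v) (c v) i) ⟩
  sum (λ v → δ (c v) (prev i) + (if d v then δ (c v) (next i) else 0))
    ≡⟨ ∑-distrib-+ (λ v → δ (c v) (prev i)) (λ v → if d v then δ (c v) (next i) else 0) ⟩
  count c (prev i) + countIf d c (next i) ∎
  where open ≡-Reasoning

-- x v = turn (d v) (c v) is next (c v) unless v is selected by d. Selecting B j vertices of each
-- colour j, with B j = M ∸ A (next j) for the largest class size M, gives x the class sizes of c;
-- B ≤ A is where 2 ≤ n is needed.
derangement : ∀ {n} (c : Fin n → Fin 3) → 2 ≤ n → Balanced (count c) →
  Σ (Fin n → Bool) λ d → ∀ i → count (λ v → turn (d v) (c v)) i ≡ count c i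
derangement {n} c 2≤n bal = d , F≡A
  where
  A : Fin 3 → ℕ
  A = count c
  M : ℕ
  M = max₃ A
  B : Fin 3 → ℕ
  B j = M ∸ A (next j)
  B≤A : ∀ j → B j ≤ A j
  B≤A j = m≤n+o⇒m∸n≤o M (A (next j)) (max₃-≤ A (count≤count-next+count c 2≤n bal j))
  d : Fin n → Bool
  d = proj₁ (select c B B≤A)
  d-counts : ∀ j → countIf d c j ≡ B j
  d-counts = proj₂ (select c B B≤A)
  F : Fin 3 → ℕ
  F = count (λ v → turn (d v) (c v))
  A+B∘prev≡M : ∀ i → A i + B (prev i) ≡ M
  A+B∘prev≡M i = subst (λ j → A i + (M ∸ A j) ≡ M) (sym (next³ i)) (m+[n∸m]≡n (≤-max₃ A i))
  F≡A : ∀ i → F i ≡ A i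
  F≡A i = +-cancelʳ-≡ (B (prev i)) _ _ (begin
    F i + B (prev i)                   ≡⟨ cong (F i +_) (d-counts (prev i)) ⟨
    F i + countIf d c (prev i)         ≡⟨ count-turn d c i ⟩
    A (prev i) + countIf d c (next i)  ≡⟨ cong (A (prev i) +_) (d-counts (next i)) ⟩
    A (prev i) + B (next i)            ≡⟨ m+[n∸m]≡n (≤-max₃ A (prev i)) ⟩
    M                                  ≡⟨ A+B∘prev≡M i ⟨
    A i + B (prev i)                   ∎)
    where open ≡-Reasoning

balanced-cong : ∀ {k} {A B : Fin k → ℕ} → (∀ i → A i ≡ B i) → Balanced B → Balanced A
balanced-cong A≡B bal i j = subst₂ (λ a b → a ≤ suc b) (sym (A≡B i)) (sym (A≡B j)) (bal i j)

balanced-corona-sizes : ∀ {m n} → m ≡ 2 ⊎ m ≡ 3 ⊎ m ≡ 5 → (A Y : Fin 3 → ℕ) →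
  (∀ i → A i + A i + Y i ≡ n) → Balanced A →
  Balanced (λ i → A i + (⌈ m /2⌉ * A i + ⌊ m /2⌋ * Y i))
balanced-corona-sizes {n = n} (inj₁ refl) A Y total _ =
  balanced-cong (λ i → trans (m≡2 (A i) (Y i)) (total i)) (λ _ _ → n≤1+n n)
  where
  m≡2 : ∀ a y → a + (1 * a + 1 * y) ≡ a + a + y
  m≡2 = solve-∀
balanced-corona-sizes {n = n} (inj₂ (inj₁ refl)) A Y total bal =
  balanced-cong (λ i → trans (m≡3 (A i) (Y i)) (cong (A i +_) (total i)))
                (λ i j → +-monoˡ-≤ n (bal i j))
  where
  m≡3 : ∀ a y → a + (2 * a + 1 * y) ≡ a + (a + a + y)
  m≡3 = solve-∀
balanced-corona-sizes {n = n} (inj₂ (inj₂ refl)) A Y total _ =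
  balanced-cong (λ i → trans (m≡5 (A i) (Y i)) (cong₂ _+_ (total i) (total i)))
                (λ _ _ → n≤1+n (n + n))
  where
  m≡5 : ∀ a y → a + (3 * a + 2 * y) ≡ (a + a + y) + (a + a + y)
  m≡5 = solve-∀

corona-P-equitable : ∀ {m} → m ≡ 2 ⊎ m ≡ 3 ⊎ m ≡ 5 → ∀ H → 2 ≤ size H →
  EquitablyColorable H 3 → EquitablyColorable (corona H (P m)) 3
corona-P-equitable {m} m∈ H 2≤n (c , c-proper , c-equitable) =
  col , col-proper , balanced⇒equitable (corona H (P m)) 3 col col-balanced
  where
  c-balanced : Balanced (count c)
  c-balanced = equitable⇒balanced H 3 c c-equitable
  d : Fin (size H) → Bool
  d = proj₁ (derangement c 2≤n c-balanced)
  x y : Fin (size H) → Fin 3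
  x v = turn (d v) (c v)
  y v = turn (not (d v)) (c v)
  count-x : ∀ i → count x i ≡ count c i
  count-x = proj₂ (derangement c 2≤n c-balanced)
  col : Fin (size (corona H (P m))) → Fin 3
  col = c ++ concat (λ v → alternate (x v) (y v) ∘ toℕ)
  col-proper : Proper (corona H (P m)) 3 col
  col-proper = corona-proper H (P m) c _ c-proper
    (λ v → alternate-proper (turn-≢-turn-not (d v) (c v)))
    (λ v j → alternate-≢ (turn-≢ (d v) (c v)) (turn-≢ (not (d v)) (c v)) (toℕ j))
  total : ∀ i → count c i + count c i + count y i ≡ size H
  total i = trans (cong (λ X → count c i + X + count y i) (sym (count-x i)))
                  (∑-partition _ _ _ (λ v → δ-turns (d v) (c v) i))
  count-col : ∀ i → count col i ≡ count c i + (⌈ m /2⌉ * count c i + ⌊ m /2⌋ * count y i)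
  count-col i = trans (count-corona-alternate m c x y i)
                      (cong (λ X → count c i + (⌈ m /2⌉ * X + ⌊ m /2⌋ * count y i)) (count-x i))
  col-balanced : Balanced (count col)
  col-balanced = balanced-cong count-col (balanced-corona-sizes m∈ (count c) (count y) total c-balanced)

coronaIter-P-equitable : ∀ {m} → m ≡ 2 ⊎ m ≡ 3 ⊎ m ≡ 5 → ∀ G → 2 ≤ size G →
  EquitablyColorable G 3 →
  ∀ l → 2 ≤ size (coronaIter G (P m) l) × EquitablyColorable (coronaIter G (P m) l) 3
coronaIter-P-equitable m∈ G 2≤n G-equitable zero = 2≤n , G-equitable
coronaIter-P-equitable m∈ G 2≤n G-equitable (suc l)
  with 2≤|H| , H-equitable ← coronaIter-P-equitable m∈ G 2≤n G-equitable l =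
  ≤-trans 2≤|H| (m≤m+n _ _) , corona-P-equitable m∈ _ 2≤|H| H-equitable

distinct₃⇒3≤ : ∀ {k} (a b c : Fin k) → a ≢ b → a ≢ c → b ≢ c → 3 ≤ k
distinct₃⇒3≤ {suc (suc (suc k))} _ _ _ _ _ _ = s≤s (s≤s (s≤s z≤n))
distinct₃⇒3≤ {1} 0F 0F _  a≢b _   _   = contradiction refl a≢b
distinct₃⇒3≤ {2} 0F 0F _  a≢b _   _   = contradiction refl a≢b
distinct₃⇒3≤ {2} 1F 1F _  a≢b _   _   = contradiction refl a≢b
distinct₃⇒3≤ {2} 0F 1F 0F _   a≢c _   = contradiction refl a≢c
distinct₃⇒3≤ {2} 1F 0F 1F _   a≢c _   = contradiction refl a≢c
distinct₃⇒3≤ {2} 0F 1F 1F _   _   b≢c = contradiction refl b≢c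
distinct₃⇒3≤ {2} 1F 0F 0F _   _   b≢c = contradiction refl b≢c

corona-colours≥3 : ∀ H F {k} (col : Fin (size (corona H F)) → Fin k) → Proper (corona H F) k col →
  Fin (size H) → ∀ j j′ → adj F j j′ ≡ true → 3 ≤ k
corona-colours≥3 H F col col-proper v j j′ j~j′ =
  distinct₃⇒3≤ (col hub) (col (copy j)) (col (copy j′))
  (col-proper hub (copy j) (corona-adj-hub-copy H F v j))
  (col-proper hub (copy j′) (corona-adj-hub-copy H F v j′))
  (col-proper (copy j) (copy j′) (trans (corona-adj-copy H F v j j′) j~j′))
  where
  hub = v ↑ˡ (size H * size F)
  copy : Fin (size F) → Fin (size (corona H F))
  copy i = size H ↑ʳ combine v i

corona-P-colours≥3 : ∀ H {m k} → Fin (size H) → 2 ≤ m →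
  EquitablyColorable (corona H (P m)) k → 3 ≤ k
corona-P-colours≥3 H v (s≤s (s≤s _)) (col , col-proper , _) =
  corona-colours≥3 H (P _) col col-proper v 0F 1F refl

theorem7 : (G : Graph) → IsSimple G → Connected G → 2 ≤ size G →
           EquitablyColorable G 3 →
           (l m : ℕ) → 1 ≤ l → (m ≡ 2 ⊎ m ≡ 3 ⊎ m ≡ 5) →
           EqChromaticIs (coronaIter G (P m) l) 3
theorem7 G _ _ 2≤n G-equitable (suc l) m _ m∈
  with 2≤|H| , H-equitable ← coronaIter-P-equitable m∈ G 2≤n G-equitable l =
  corona-P-equitable m∈ H 2≤|H| H-equitable ,
  λ k → corona-P-colours≥3 H (fromℕ< 2≤|H|) (2≤m m∈)
  where
  H = coronaIter G (P m) l
  2≤m : m ≡ 2 ⊎ m ≡ 3 ⊎ m ≡ 5 → 2 ≤ m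
  2≤m (inj₁ refl)        = s≤s (s≤s z≤n)
  2≤m (inj₂ (inj₁ refl)) = s≤s (s≤s z≤n)
  2≤m (inj₂ (inj₂ refl)) = s≤s (s≤s z≤n)
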